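{- Fix $n\ge 1$. For a tb-diagram $\mathsf d$ with $n$ arcs, label the $2n$ endpoints of its arcs by $0,1,\dots,2n-1$ from left to right, and associate to $\mathsf d$ the set $S(\mathsf d)$ consisting of: the labels of the right endpoints of all arcs in the first block, and, for each subsequent block, the labels of the left endpoints of all arcs in that block if this block is joined by a tie to the preceding block, and the labels of the right endpoints of all arcs in that block otherwise. Then $\mathsf d\mapsto S(\mathsf d)$ is a bijection from the set of tb-diagrams with $n$ arcs onto the set of $n$-element subsets of $\{1,2,\dots,2n-1\}$.
   Context: An $n$-arcdiagram is a planar diagram of $n$ pairwise non-intersecting semicircles (arcs) in the closed upper half-plane with their $2n$ endpoints on a horizontal line, considered up to isotopy (i.e. determined by the non-crossing perfect matching of the endpoints). A top arc is an arc not contained inside any other arc; top arcs are ordered from left to right. A block is the region bounded by a top arc together with all arcs inside it; blocks are ordered from left to right. A tb-diagram is an arcdiagram together with ties lying only in the unbounded complementary region and connecting only successive top arcs; equivalently, an arcdiagram together with a choice, for each pair of successive blocks, of whether or not they are joined by a tie. -}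

module Defs where

open import Data.Nat using (ℕ; zero; suc; _+_; _*_; _∸_; _≤_; _≟_)
open import Data.Bool using (Bool; true; false; if_then_else_)
open import Data.List using (List; []; _∷_; _++_; [_]; length)
open import Data.Vec using (Vec; []; _∷_; tabulate)
open import Data.Fin using (Fin; toℕ)
open import Data.Fin.Subset using (Subset; inside; outside; _∈_; ∣_∣)
open import Data.Product using (_×_)
open import Relation.Nullary using (does)

-- An arcdiagram is determined by its non-crossing perfect matching, which is
-- encoded canonically by its nesting structure: a block is a top arc together
-- with the arcdiagram inside it; an arcdiagram is the list of its blocks
-- (left to right).
data Block : Set where
  node : List Block → Block

ArcDiagram : Set
ArcDiagram = List Block

mutual
  arcsB : Block → ℕ
  arcsB (node f) = suc (arcsF f)

  arcsF : List Block → ℕ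
  arcsF [] = zero
  arcsF (b ∷ f) = arcsB b + arcsF f

-- labels of left endpoints of all arcs of a block whose leftmost endpoint has label o
mutual
  leftsB : ℕ → Block → List ℕ
  leftsB o (node f) = o ∷ leftsF (suc o) f

  leftsF : ℕ → List Block → List ℕ
  leftsF o [] = []
  leftsF o (b ∷ f) = leftsB o b ++ leftsF (o + 2 * arcsB b) f

-- labels of right endpoints of all arcs of a block whose leftmost endpoint has label o
mutual
  rightsB : ℕ → Block → List ℕ
  rightsB o (node f) = rightsF (suc o) f ++ [ suc o + 2 * arcsF f ]

  rightsF : ℕ → List Block → List ℕ
  rightsF o [] = []
  rightsF o (b ∷ f) = rightsB o b ++ rightsF (o + 2 * arcsB b) f

-- A tb-diagram: an arcdiagram plus, for each pair of successive blocks
-- (block i, block i+1), a Bool saying whether they are joined by a tie.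
record TBDiagram : Set where
  constructor tb
  field
    blocks : ArcDiagram
    ties   : Vec Bool (length blocks ∸ 1)
open TBDiagram public

arcs : TBDiagram → ℕ
arcs d = arcsF (blocks d)

-- labels contributed by the blocks after the first; o = label of the leftmost
-- endpoint of the current block; the Bool says whether it is tied to the preceding block
restLabels : ℕ → (bs : List Block) → Vec Bool (length bs) → List ℕ
restLabels o [] [] = []
restLabels o (b ∷ bs) (t ∷ ts) =
  (if t then leftsB o b else rightsB o b) ++ restLabels (o + 2 * arcsB b) bs ts

SLabels : TBDiagram → List ℕ
SLabels (tb [] []) = []
SLabels (tb (b ∷ bs) ts) = rightsB 0 b ++ restLabels (2 * arcsB b) bs ts

memb : ℕ → List ℕ → Bool
memb x [] = false
memb x (y ∷ ys) = if does (x ≟ y) then true else memb x ys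

S : (N : ℕ) → TBDiagram → Subset N
S N d = tabulate (λ i → if memb (toℕ i) (SLabels d) then inside else outside)

-- n-element subsets of {1,…,2n-1}, viewed inside {0,…,2n-1}
IsTarget : (n : ℕ) → Subset (2 * n) → Set
IsTarget n s = (∣ s ∣ ≡ n) × (∀ i → i ∈ s → 1 ≤ toℕ i)
  where open import Relation.Binary.PropositionalEquality using (_≡_)

-- Read S(d) as a word in {false, true} (letter k is true iff k ∈ S(d)).  Each block then
-- contributes a bracket word for its arcs, opened by false if the block is untied (as the
-- first block is) and by true if it is tied to its predecessor.  Conversely, a word with n
-- letters of each kind splits uniquely into minimal balanced factors, each a bracket word
-- opened by its own first letter; this recovers the blocks and the ties, and the first
-- letter being false (0 ∉ S) says the first block is untied.  The factorisation is computed
-- by a left-to-right stack parser, which inverts the encoding and, on a balanced word,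
-- finishes with an empty stack.
module Submission where

open import Defs
open import Data.Nat using (ℕ; _≤_; _*_)
open import Data.Fin.Subset using (Subset)
open import Data.Product using (_×_; ∃-syntax)
open import Relation.Binary.PropositionalEquality using (_≡_)

open import Data.Bool using (Bool; true; false; not; if_then_else_)
open import Data.Fin using (toℕ) renaming (zero to fzero; suc to fsuc)
open import Data.Fin.Subset using (∣_∣; _∈_; inside; outside)
open import Data.List using (List; []; _∷_; _++_; [_]; length; reverse; _ʳ++_)
open import Data.List.Properties using (++-assoc; ∷-injectiveˡ; ∷-injectiveʳ; reverse-involutive)
open import Data.Nat using (zero; suc; _+_; _<_; _≟_; z≤n; s≤s)
open import Data.Nat.Properties
  using (≤-reflexive; <⇒≢; m<n⇒m<1+n; +-identityʳ; +-suc; +-assoc; +-cancelˡ-≡; +-cancelʳ-≡; m+1+n≢m; *-identityʳ; *-zeroʳ)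
open import Data.Nat.Tactic.RingSolver using (solve-∀)
open import Data.Product using (Σ; _,_)
open import Function using (_∘_)
open import Data.Vec using (Vec; []; _∷_; tabulate; toList; here)
open import Data.Vec.Properties using (tabulate-cong; length-toList)
open import Relation.Binary.PropositionalEquality using (_≢_; refl; sym; subst; trans; cong; cong₂; module ≡-Reasoning)
open import Relation.Nullary.Decidable using (dec-true; dec-false)

open ≡-Reasoning

mutual
  blockWord : Bool → Block → List Bool → List Bool
  blockWord s (node f) r = s ∷ forestWord s f (not s ∷ r)

  forestWord : Bool → List Block → List Bool → List Bool
  forestWord s []      r = r
  forestWord s (b ∷ f) r = blockWord s b (forestWord s f r)

Tagged : Set
Tagged = List (Bool × Block)

taggedWord : Tagged → List Bool → List Bool
taggedWord []            r = r
taggedWord ((t , b) ∷ l) r = blockWord t b (taggedWord l r)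

tagBlocks : (bs : List Block) → Vec Bool (length bs) → Tagged
tagBlocks []       []       = []
tagBlocks (b ∷ bs) (t ∷ ts) = (t , b) ∷ tagBlocks bs ts

tagged : TBDiagram → Tagged
tagged (tb []       [])  = []
tagged (tb (b ∷ bs) ts)  = (false , b) ∷ tagBlocks bs ts

word : TBDiagram → List Bool
word d = taggedWord (tagged d) []

positions : ℕ → List Bool → List ℕ
positions o []          = []
positions o (true  ∷ w) = o ∷ positions (suc o) w
positions o (false ∷ w) = positions (suc o) w

endpointsB : Bool → ℕ → Block → List ℕ
endpointsB t o b = if t then leftsB o b else rightsB o b

endpointsF : Bool → ℕ → List Block → List ℕ
endpointsF t o f = if t then leftsF o f else rightsF o f

endpointsF-∷ : ∀ t o b f → endpointsF t o (b ∷ f) ≡ endpointsB t o b ++ endpointsF t (o + 2 * arcsB b) f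
endpointsF-∷ true  o b f = refl
endpointsF-∷ false o b f = refl

private
  offset-node : ∀ o a → suc (suc o + 2 * a) ≡ o + 2 * suc a
  offset-node = solve-∀

  offset-+ : ∀ o a b → o + 2 * a + 2 * b ≡ o + 2 * (a + b)
  offset-+ = solve-∀

mutual
  positions-blockWord : ∀ s o b r →
    positions o (blockWord s b r) ≡ endpointsB s o b ++ positions (o + 2 * arcsB b) r
  positions-blockWord true o (node f) r = cong (o ∷_) (begin
    positions (suc o) (forestWord true f (false ∷ r))
      ≡⟨ positions-forestWord true (suc o) f (false ∷ r) ⟩
    leftsF (suc o) f ++ positions (suc (suc o + 2 * arcsF f)) r
      ≡⟨ cong (λ k → leftsF (suc o) f ++ positions k r) (offset-node o (arcsF f)) ⟩
    leftsF (suc o) f ++ positions (o + 2 * suc (arcsF f)) r ∎)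
  positions-blockWord false o (node f) r = begin
    positions (suc o) (forestWord false f (true ∷ r))
      ≡⟨ positions-forestWord false (suc o) f (true ∷ r) ⟩
    rightsF (suc o) f ++ top ∷ positions (suc top) r
      ≡⟨ cong (λ k → rightsF (suc o) f ++ top ∷ positions k r) (offset-node o (arcsF f)) ⟩
    rightsF (suc o) f ++ [ top ] ++ positions (o + 2 * suc (arcsF f)) r
      ≡⟨ sym (++-assoc (rightsF (suc o) f) _ _) ⟩
    rightsB o (node f) ++ positions (o + 2 * suc (arcsF f)) r ∎
    where
    top : ℕ
    top = suc o + 2 * arcsF f

  positions-forestWord : ∀ s o f r →
    positions o (forestWord s f r) ≡ endpointsF s o f ++ positions (o + 2 * arcsF f) r
  positions-forestWord true  o [] r = cong (λ k → positions k r) (sym (+-identityʳ o))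
  positions-forestWord false o [] r = cong (λ k → positions k r) (sym (+-identityʳ o))
  positions-forestWord s o (b ∷ f) r = begin
    positions o (blockWord s b (forestWord s f r))
      ≡⟨ positions-blockWord s o b _ ⟩
    endpointsB s o b ++ positions o′ (forestWord s f r)
      ≡⟨ cong (endpointsB s o b ++_) (positions-forestWord s o′ f r) ⟩
    endpointsB s o b ++ endpointsF s o′ f ++ positions (o′ + 2 * arcsF f) r
      ≡⟨ cong (λ k → endpointsB s o b ++ endpointsF s o′ f ++ positions k r) (offset-+ o (arcsB b) (arcsF f)) ⟩
    endpointsB s o b ++ endpointsF s o′ f ++ positions (o + 2 * arcsF (b ∷ f)) r
      ≡⟨ sym (++-assoc (endpointsB s o b) _ _) ⟩
    (endpointsB s o b ++ endpointsF s o′ f) ++ positions (o + 2 * arcsF (b ∷ f)) r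
      ≡⟨ cong (_++ _) (sym (endpointsF-∷ s o b f)) ⟩
    endpointsF s o (b ∷ f) ++ positions (o + 2 * arcsF (b ∷ f)) r ∎
    where
    o′ : ℕ
    o′ = o + 2 * arcsB b

restLabels≡positions : ∀ o bs ts → restLabels o bs ts ≡ positions o (taggedWord (tagBlocks bs ts) [])
restLabels≡positions o []       []       = refl
restLabels≡positions o (b ∷ bs) (t ∷ ts) = begin
  endpointsB t o b ++ restLabels (o + 2 * arcsB b) bs ts
    ≡⟨ cong (endpointsB t o b ++_) (restLabels≡positions _ bs ts) ⟩
  endpointsB t o b ++ positions (o + 2 * arcsB b) (taggedWord (tagBlocks bs ts) [])
    ≡⟨ sym (positions-blockWord t o b _) ⟩
  positions o (blockWord t b (taggedWord (tagBlocks bs ts) [])) ∎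

SLabels≡positions : ∀ d → SLabels d ≡ positions 0 (word d)
SLabels≡positions (tb []       [])  = refl
SLabels≡positions (tb (b ∷ bs) ts)  = begin
  rightsB 0 b ++ restLabels (2 * arcsB b) bs ts
    ≡⟨ cong (rightsB 0 b ++_) (restLabels≡positions _ bs ts) ⟩
  rightsB 0 b ++ positions (2 * arcsB b) (taggedWord (tagBlocks bs ts) [])
    ≡⟨ sym (positions-blockWord false 0 b _) ⟩
  positions 0 (word (tb (b ∷ bs) ts)) ∎

bitAt : List Bool → ℕ → Bool
bitAt []      k       = false
bitAt (x ∷ w) zero    = x
bitAt (x ∷ w) (suc k) = bitAt w k

first-letter-word : ∀ d → bitAt (word d) 0 ≡ false
first-letter-word (tb []           [])  = refl
first-letter-word (tb (node _ ∷ _) _)   = refl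

memb-here : ∀ x ys → memb x (x ∷ ys) ≡ true
memb-here x ys = cong (λ b → if b then true else memb x ys) (dec-true (x ≟ x) refl)

memb-there : ∀ {x y} ys → x ≢ y → memb x (y ∷ ys) ≡ memb x ys
memb-there {x} {y} ys x≢y = cong (λ b → if b then true else memb x ys) (dec-false (x ≟ y) x≢y)

memb-positions-below : ∀ k o w → k < o → memb k (positions o w) ≡ false
memb-positions-below k o []          k<o = refl
memb-positions-below k o (false ∷ w) k<o = memb-positions-below k (suc o) w (m<n⇒m<1+n k<o)
memb-positions-below k o (true ∷ w)  k<o =
  trans (memb-there (positions (suc o) w) (<⇒≢ k<o)) (memb-positions-below k (suc o) w (m<n⇒m<1+n k<o))

memb-positions : ∀ o k w → memb (o + k) (positions o w) ≡ bitAt w k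
memb-positions o k       []          = refl
memb-positions o zero    (false ∷ w) =
  memb-positions-below (o + 0) (suc o) w (s≤s (≤-reflexive (+-identityʳ o)))
memb-positions o zero    (true ∷ w)  =
  trans (cong (λ m → memb m (o ∷ positions (suc o) w)) (+-identityʳ o)) (memb-here o (positions (suc o) w))
memb-positions o (suc k) (false ∷ w) =
  trans (cong (λ m → memb m (positions (suc o) w)) (+-suc o k)) (memb-positions (suc o) k w)
memb-positions o (suc k) (true ∷ w)  =
  trans (memb-there (positions (suc o) w) (m+1+n≢m o))
    (trans (cong (λ m → memb m (positions (suc o) w)) (+-suc o k)) (memb-positions (suc o) k w))

toSubset : (N : ℕ) → List Bool → Subset N
toSubset N w = tabulate (λ i → if bitAt w (toℕ i) then inside else outside)

S≡toSubset-word : ∀ N d → S N d ≡ toSubset N (word d)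
S≡toSubset-word N d = tabulate-cong λ i →
  cong (λ b → if b then inside else outside)
    (trans (cong (memb (toℕ i)) (SLabels≡positions d)) (memb-positions 0 (toℕ i) (word d)))

toList-toSubset : ∀ N w → length w ≡ N → toList (toSubset N w) ≡ w
toList-toSubset zero    []          refl = refl
toList-toSubset (suc N) (true  ∷ w) refl = cong (true ∷_) (toList-toSubset N w refl)
toList-toSubset (suc N) (false ∷ w) refl = cong (false ∷_) (toList-toSubset N w refl)

toSubset-toList : ∀ {N} (v : Subset N) → toSubset N (toList v) ≡ v
toSubset-toList []          = refl
toSubset-toList (true  ∷ v) = cong (true ∷_) (toSubset-toList v)
toSubset-toList (false ∷ v) = cong (false ∷_) (toSubset-toList v)

avoids-0⇒bitAt-0 : ∀ {N} (v : Subset N) → (∀ i → i ∈ v → 1 ≤ toℕ i) → bitAt (toList v) 0 ≡ false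
avoids-0⇒bitAt-0 []          _   = refl
avoids-0⇒bitAt-0 (false ∷ v) _   = refl
avoids-0⇒bitAt-0 (true  ∷ v) 0∉v with 0∉v fzero here
... | ()

bitAt-0⇒avoids-0 : ∀ {N} (v : Subset N) → bitAt (toList v) 0 ≡ false → ∀ i → i ∈ v → 1 ≤ toℕ i
bitAt-0⇒avoids-0 (false ∷ v) _ fzero    ()
bitAt-0⇒avoids-0 (x ∷ v)     _ (fsuc i) _ = s≤s z≤n

δ : Bool → Bool → ℕ
δ true  true  = 1
δ false false = 1
δ true  false = 0
δ false true  = 0

δ-self : ∀ b → δ b b ≡ 1
δ-self true  = refl
δ-self false = refl

δ-not-self : ∀ b → δ (not b) b ≡ 0
δ-not-self true  = refl
δ-not-self false = refl

δ-+-δ-not : ∀ b s → δ b s + δ b (not s) ≡ 1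
δ-+-δ-not true  true  = refl
δ-+-δ-not true  false = refl
δ-+-δ-not false true  = refl
δ-+-δ-not false false = refl

occurrences : Bool → List Bool → ℕ
occurrences b []      = 0
occurrences b (x ∷ w) = δ b x + occurrences b w

Balanced : List Bool → Set
Balanced w = occurrences true w ≡ occurrences false w

Balanced⇒occurrences-not : ∀ {w} → Balanced w → ∀ s → occurrences s w ≡ occurrences (not s) w
Balanced⇒occurrences-not eq true  = eq
Balanced⇒occurrences-not eq false = sym eq

length≡occurrences-+ : ∀ w → length w ≡ occurrences true w + occurrences false w
length≡occurrences-+ []          = refl
length≡occurrences-+ (true  ∷ w) = cong suc (length≡occurrences-+ w)
length≡occurrences-+ (false ∷ w) = trans (cong suc (length≡occurrences-+ w)) (sym (+-suc _ _))

occurrences-true-toList : ∀ {N} (v : Subset N) → occurrences true (toList v) ≡ ∣ v ∣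
occurrences-true-toList []          = refl
occurrences-true-toList (true  ∷ v) = cong suc (occurrences-true-toList v)
occurrences-true-toList (false ∷ v) = occurrences-true-toList v

mutual
  occurrences-blockWord : ∀ b s x r → occurrences b (blockWord s x r) ≡ arcsB x + occurrences b r
  occurrences-blockWord b s (node f) r = begin
    δ b s + occurrences b (forestWord s f (not s ∷ r))
      ≡⟨ cong (δ b s +_) (occurrences-forestWord b s f (not s ∷ r)) ⟩
    δ b s + (arcsF f + (δ b (not s) + occurrences b r))
      ≡⟨ regroup (δ b s) (δ b (not s)) (arcsF f) (occurrences b r) ⟩
    (δ b s + δ b (not s)) + (arcsF f + occurrences b r)
      ≡⟨ cong (_+ (arcsF f + occurrences b r)) (δ-+-δ-not b s) ⟩
    suc (arcsF f + occurrences b r) ∎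
    where
    regroup : ∀ p q a c → p + (a + (q + c)) ≡ (p + q) + (a + c)
    regroup = solve-∀

  occurrences-forestWord : ∀ b s f r → occurrences b (forestWord s f r) ≡ arcsF f + occurrences b r
  occurrences-forestWord b s []      r = refl
  occurrences-forestWord b s (x ∷ f) r = begin
    occurrences b (blockWord s x (forestWord s f r))
      ≡⟨ occurrences-blockWord b s x _ ⟩
    arcsB x + occurrences b (forestWord s f r)
      ≡⟨ cong (arcsB x +_) (occurrences-forestWord b s f r) ⟩
    arcsB x + (arcsF f + occurrences b r)
      ≡⟨ sym (+-assoc (arcsB x) _ _) ⟩
    arcsF (x ∷ f) + occurrences b r ∎

occurrences-tagBlocks : ∀ b bs ts → occurrences b (taggedWord (tagBlocks bs ts) []) ≡ arcsF bs
occurrences-tagBlocks b []       []       = refl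
occurrences-tagBlocks b (x ∷ bs) (t ∷ ts) =
  trans (occurrences-blockWord b t x _) (cong (arcsB x +_) (occurrences-tagBlocks b bs ts))

occurrences-word : ∀ b d → occurrences b (word d) ≡ arcs d
occurrences-word b (tb []       [])  = refl
occurrences-word b (tb (x ∷ bs) ts)  =
  trans (occurrences-blockWord b false x _) (cong (arcsB x +_) (occurrences-tagBlocks b bs ts))

length-word : ∀ d → length (word d) ≡ 2 * arcs d
length-word d = begin
  length (word d)                                        ≡⟨ length≡occurrences-+ (word d) ⟩
  occurrences true (word d) + occurrences false (word d) ≡⟨ cong₂ _+_ (occurrences-word true d) (occurrences-word false d) ⟩
  arcs d + arcs d                                        ≡⟨ double (arcs d) ⟩
  2 * arcs d                                             ∎
  where
  double : ∀ a → a + a ≡ 2 * a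
  double = solve-∀

tagBlocks-injective : ∀ {bs bs′} ts ts′ → tagBlocks bs ts ≡ tagBlocks bs′ ts′ →
  _≡_ {A = Σ (List Block) (Vec Bool ∘ length)} (bs , ts) (bs′ , ts′)
tagBlocks-injective {[]}    {[]}      []       []         _  = refl
tagBlocks-injective {[]}    {_ ∷ _}   []       (_ ∷ _)    ()
tagBlocks-injective {_ ∷ _} {[]}      (_ ∷ _)  []         ()
tagBlocks-injective {b ∷ _} {b′ ∷ _}  (t ∷ ts) (t′ ∷ ts′) eq
  with ∷-injectiveˡ eq | tagBlocks-injective ts ts′ (∷-injectiveʳ eq)
... | refl | refl = refl

tagged-injective : ∀ d d′ → tagged d ≡ tagged d′ → d ≡ d′
tagged-injective (tb []      [])  (tb []      [])  _  = refl
tagged-injective (tb []      [])  (tb (_ ∷ _) _)   ()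
tagged-injective (tb (_ ∷ _) _)   (tb []      [])  ()
tagged-injective (tb (b ∷ _) ts)  (tb (b′ ∷ _) ts′) eq
  with ∷-injectiveˡ eq | tagBlocks-injective ts ts′ (∷-injectiveʳ eq)
... | refl | refl = refl

tagBlocks-surjective : ∀ l → ∃[ bs ] ∃[ ts ] tagBlocks bs ts ≡ l
tagBlocks-surjective [] = [] , [] , refl
tagBlocks-surjective ((t , b) ∷ l) with tagBlocks-surjective l
... | bs , ts , refl = b ∷ bs , t ∷ ts , refl

tagged-surjective : ∀ l → bitAt (taggedWord l []) 0 ≡ false → ∃[ d ] tagged d ≡ l
tagged-surjective [] _ = tb [] [] , refl
tagged-surjective ((false , b) ∷ l) _ with tagBlocks-surjective l
... | bs , ts , refl = tb (b ∷ bs) ts , refl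
tagged-surjective ((true , node f) ∷ l) ()

-- A frame of the stack holds the blocks already completed inside one open arc,
-- most recent first; the completed top-level blocks are likewise kept reversed.
Stack : Set
Stack = List (List Block)

record State : Set where
  constructor state
  field
    opener : Bool
    stack  : Stack
    done   : Tagged

mutual
  parse : Bool → Stack → Tagged → List Bool → State
  parse s     st       acc []          = state s st acc
  parse _     []       acc (x ∷ w)     = parse x ([] ∷ []) acc w
  parse true  (h ∷ st) acc (true  ∷ w) = parse true ([] ∷ h ∷ st) acc w
  parse false (h ∷ st) acc (false ∷ w) = parse false ([] ∷ h ∷ st) acc w
  parse true  (h ∷ st) acc (false ∷ w) = close true h st acc w
  parse false (h ∷ st) acc (true  ∷ w) = close false h st acc w

  close : Bool → List Block → Stack → Tagged → List Bool → State
  close s h []       acc w = parse s [] ((s , node (reverse h)) ∷ acc) w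
  close s h (g ∷ st) acc w = parse s ((node (reverse h) ∷ g) ∷ st) acc w

parse-open : ∀ s h st acc w → parse s (h ∷ st) acc (s ∷ w) ≡ parse s ([] ∷ h ∷ st) acc w
parse-open true  h st acc w = refl
parse-open false h st acc w = refl

parse-close : ∀ s h st acc w → parse s (h ∷ st) acc (not s ∷ w) ≡ close s h st acc w
parse-close true  h st acc w = refl
parse-close false h st acc w = refl

mutual
  parse-forestWord : ∀ s f r h st acc →
    parse s (h ∷ st) acc (forestWord s f r) ≡ parse s ((f ʳ++ h) ∷ st) acc r
  parse-forestWord s []      r h st acc = refl
  parse-forestWord s (b ∷ f) r h st acc =
    trans (parse-blockWord s b (forestWord s f r) h st acc) (parse-forestWord s f r (b ∷ h) st acc)

  parse-blockWord : ∀ s b r g st acc →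
    parse s (g ∷ st) acc (blockWord s b r) ≡ parse s ((b ∷ g) ∷ st) acc r
  parse-blockWord s (node f) r g st acc = begin
    parse s (g ∷ st) acc (s ∷ forestWord s f (not s ∷ r))
      ≡⟨ parse-open s g st acc _ ⟩
    parse s ([] ∷ g ∷ st) acc (forestWord s f (not s ∷ r))
      ≡⟨ parse-forestWord s f (not s ∷ r) [] (g ∷ st) acc ⟩
    parse s (reverse f ∷ g ∷ st) acc (not s ∷ r)
      ≡⟨ parse-close s (reverse f) (g ∷ st) acc r ⟩
    parse s ((node (reverse (reverse f)) ∷ g) ∷ st) acc r
      ≡⟨ cong (λ f′ → parse s ((node f′ ∷ g) ∷ st) acc r) (reverse-involutive f) ⟩
    parse s ((node f ∷ g) ∷ st) acc r ∎

parse-topBlockWord : ∀ s t b r acc → parse s [] acc (blockWord t b r) ≡ parse t [] ((t , b) ∷ acc) r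
parse-topBlockWord s t (node f) r acc = begin
  parse t ([] ∷ []) acc (forestWord t f (not t ∷ r))
    ≡⟨ parse-forestWord t f (not t ∷ r) [] [] acc ⟩
  parse t (reverse f ∷ []) acc (not t ∷ r)
    ≡⟨ parse-close t (reverse f) [] acc r ⟩
  parse t [] ((t , node (reverse (reverse f))) ∷ acc) r
    ≡⟨ cong (λ f′ → parse t [] ((t , node f′) ∷ acc) r) (reverse-involutive f) ⟩
  parse t [] ((t , node f) ∷ acc) r ∎

done-parse-taggedWord : ∀ s l acc → State.done (parse s [] acc (taggedWord l [])) ≡ l ʳ++ acc
done-parse-taggedWord s []            acc = refl
done-parse-taggedWord s ((t , b) ∷ l) acc =
  trans (cong State.done (parse-topBlockWord s t b _ acc)) (done-parse-taggedWord t l ((t , b) ∷ acc))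

decode : List Bool → Tagged
decode w = reverse (State.done (parse false [] [] w))

decode-taggedWord : ∀ l → decode (taggedWord l []) ≡ l
decode-taggedWord l = trans (cong reverse (done-parse-taggedWord false l [])) (reverse-involutive l)

word-injective : ∀ d d′ → word d ≡ word d′ → d ≡ d′
word-injective d d′ eq = tagged-injective d d′ (begin
  tagged d                ≡⟨ sym (decode-taggedWord (tagged d)) ⟩
  decode (word d)         ≡⟨ cong decode eq ⟩
  decode (word d′)        ≡⟨ decode-taggedWord (tagged d′) ⟩
  tagged d′               ∎)

doneWord : Tagged → List Bool → List Bool
doneWord []              r = r
doneWord ((t , b) ∷ acc) r = doneWord acc (blockWord t b r)

frameWord : Bool → List Block → List Bool → List Bool
frameWord s []      r = r
frameWord s (b ∷ h) r = frameWord s h (blockWord s b r)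

stackWord : Bool → Stack → List Bool → List Bool
stackWord s []       r = r
stackWord s (h ∷ st) r = stackWord s st (s ∷ frameWord s h r)

stateWord : State → List Bool → List Bool
stateWord (state s st acc) r = doneWord acc (stackWord s st r)

doneWord-taggedWord : ∀ acc l r → doneWord acc (taggedWord l r) ≡ taggedWord (acc ʳ++ l) r
doneWord-taggedWord []              l r = refl
doneWord-taggedWord ((t , b) ∷ acc) l r = doneWord-taggedWord acc ((t , b) ∷ l) r

frameWord-forestWord : ∀ s h a r → frameWord s h (forestWord s a r) ≡ forestWord s (h ʳ++ a) r
frameWord-forestWord s []      a r = refl
frameWord-forestWord s (b ∷ h) a r = frameWord-forestWord s h (b ∷ a) r

mutual
  stateWord-parse : ∀ s st acc w → stateWord (parse s st acc w) [] ≡ stateWord (state s st acc) w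
  stateWord-parse s     st       acc []          = refl
  stateWord-parse _     []       acc (x ∷ w)     = stateWord-parse x ([] ∷ []) acc w
  stateWord-parse true  (h ∷ st) acc (true  ∷ w) = stateWord-parse true ([] ∷ h ∷ st) acc w
  stateWord-parse false (h ∷ st) acc (false ∷ w) = stateWord-parse false ([] ∷ h ∷ st) acc w
  stateWord-parse true  (h ∷ st) acc (false ∷ w) = stateWord-close true h st acc w
  stateWord-parse false (h ∷ st) acc (true  ∷ w) = stateWord-close false h st acc w

  stateWord-close : ∀ s h st acc w →
    stateWord (close s h st acc w) [] ≡ stateWord (state s (h ∷ st) acc) (not s ∷ w)
  stateWord-close s h [] acc w =
    trans (stateWord-parse s [] ((s , node (reverse h)) ∷ acc) w)
      (cong (λ u → doneWord acc (s ∷ u)) (sym (frameWord-forestWord s h [] (not s ∷ w))))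
  stateWord-close s h (g ∷ st) acc w =
    trans (stateWord-parse s ((node (reverse h) ∷ g) ∷ st) acc w)
      (cong (λ u → doneWord acc (stackWord s st (s ∷ frameWord s g (s ∷ u))))
        (sym (frameWord-forestWord s h [] (not s ∷ w))))

arcsTagged : Tagged → ℕ
arcsTagged []            = 0
arcsTagged ((_ , b) ∷ l) = arcsB b + arcsTagged l

arcsStack : Stack → ℕ
arcsStack []       = 0
arcsStack (h ∷ st) = arcsF h + arcsStack st

private
  swap-+ : ∀ a b c → a + (b + c) ≡ b + a + c
  swap-+ = solve-∀

occurrences-doneWord : ∀ b acc r → occurrences b (doneWord acc r) ≡ arcsTagged acc + occurrences b r
occurrences-doneWord b []               r = refl
occurrences-doneWord b ((t , x) ∷ acc) r =
  trans (occurrences-doneWord b acc (blockWord t x r))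
    (trans (cong (arcsTagged acc +_) (occurrences-blockWord b t x r)) (swap-+ (arcsTagged acc) (arcsB x) _))

occurrences-frameWord : ∀ b s h r → occurrences b (frameWord s h r) ≡ arcsF h + occurrences b r
occurrences-frameWord b s []      r = refl
occurrences-frameWord b s (x ∷ h) r =
  trans (occurrences-frameWord b s h (blockWord s x r))
    (trans (cong (arcsF h +_) (occurrences-blockWord b s x r)) (swap-+ (arcsF h) (arcsB x) _))

-- Every open arc contributes one unmatched opening letter s.
occurrences-stackWord : ∀ b s st r →
  occurrences b (stackWord s st r) ≡ length st * δ b s + (arcsStack st + occurrences b r)
occurrences-stackWord b s []       r = refl
occurrences-stackWord b s (h ∷ st) r = begin
  occurrences b (stackWord s st (s ∷ frameWord s h r))
    ≡⟨ occurrences-stackWord b s st _ ⟩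
  length st * δ b s + (arcsStack st + (δ b s + occurrences b (frameWord s h r)))
    ≡⟨ cong (λ m → length st * δ b s + (arcsStack st + (δ b s + m))) (occurrences-frameWord b s h r) ⟩
  length st * δ b s + (arcsStack st + (δ b s + (arcsF h + occurrences b r)))
    ≡⟨ regroup (length st) (δ b s) (arcsStack st) (arcsF h) (occurrences b r) ⟩
  suc (length st) * δ b s + (arcsF h + arcsStack st + occurrences b r) ∎
  where
  regroup : ∀ l d x a c → l * d + (x + (d + (a + c))) ≡ suc l * d + (a + x + c)
  regroup = solve-∀

Balanced⇒length-stack≡0 : ∀ s st acc → Balanced (stateWord (state s st acc) []) → length st ≡ 0
Balanced⇒length-stack≡0 s st acc bal = begin
  L            ≡⟨ sym (*-identityʳ L) ⟩
  L * 1        ≡⟨ cong (L *_) (sym (δ-self s)) ⟩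
  L * δ s s    ≡⟨ +-cancelʳ-≡ K _ _ (+-cancelˡ-≡ A _ _ (begin
      A + (L * δ s s + K)             ≡⟨ sym (occurrences-state s) ⟩
      occurrences s w                 ≡⟨ Balanced⇒occurrences-not {w} bal s ⟩
      occurrences (not s) w           ≡⟨ occurrences-state (not s) ⟩
      A + (L * δ (not s) s + K)       ∎)) ⟩
  L * δ (not s) s ≡⟨ cong (L *_) (δ-not-self s) ⟩
  L * 0        ≡⟨ *-zeroʳ L ⟩
  0            ∎
  where
  L A K : ℕ
  L = length st
  A = arcsTagged acc
  K = arcsStack st + 0
  w : List Bool
  w = stateWord (state s st acc) []
  occurrences-state : ∀ b → occurrences b w ≡ A + (L * δ b s + K)
  occurrences-state b =
    trans (occurrences-doneWord b acc _) (cong (A +_) (occurrences-stackWord b s st []))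

Balanced⇒stack≡[] : ∀ s st acc → Balanced (stateWord (state s st acc) []) → st ≡ []
Balanced⇒stack≡[] s []      acc _   = refl
Balanced⇒stack≡[] s (h ∷ st) acc bal with Balanced⇒length-stack≡0 s (h ∷ st) acc bal
... | ()

taggedWord-decode : ∀ w → Balanced w → taggedWord (decode w) [] ≡ w
taggedWord-decode w bal with parse false [] [] w | stateWord-parse false [] [] w
... | state s st acc | eq with Balanced⇒stack≡[] s st acc (subst Balanced (sym eq) bal)
... | refl = trans (sym (doneWord-taggedWord acc [] [])) eq

word-surjective : ∀ w → Balanced w → bitAt w 0 ≡ false → ∃[ d ] word d ≡ w
word-surjective w bal w₀≡false
  with tagged-surjective (decode w) (subst (λ u → bitAt u 0 ≡ false) (sym (taggedWord-decode w bal)) w₀≡false)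
... | d , eq = d , trans (cong (λ l → taggedWord l []) eq) (taggedWord-decode w bal)

half-true⇒Balanced : ∀ n w → length w ≡ 2 * n → occurrences true w ≡ n → Balanced w
half-true⇒Balanced n w len occ = trans occ (+-cancelˡ-≡ n _ _ (begin
  n + n                                       ≡⟨ double n ⟩
  2 * n                                       ≡⟨ sym len ⟩
  length w                                    ≡⟨ length≡occurrences-+ w ⟩
  occurrences true w + occurrences false w    ≡⟨ cong (_+ occurrences false w) occ ⟩
  n + occurrences false w                     ∎))
  where
  double : ∀ a → a + a ≡ 2 * a
  double = solve-∀

toList-S : ∀ {n} d → arcs d ≡ n → toList (S (2 * n) d) ≡ word d
toList-S d refl = trans (cong toList (S≡toSubset-word _ d)) (toList-toSubset _ (word d) (length-word d))

S-IsTarget : ∀ d → IsTarget (arcs d) (S (2 * arcs d) d)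
S-IsTarget d =
  trans (sym (occurrences-true-toList (S (2 * arcs d) d)))
    (trans (cong (occurrences true) (toList-S d refl)) (occurrences-word true d)) ,
  bitAt-0⇒avoids-0 (S (2 * arcs d) d) (trans (cong (λ u → bitAt u 0) (toList-S d refl)) (first-letter-word d))

S-injective : ∀ {n} d d′ → arcs d ≡ n → arcs d′ ≡ n → S (2 * n) d ≡ S (2 * n) d′ → d ≡ d′
S-injective d d′ arcs≡n arcs′≡n eq =
  word-injective d d′ (trans (sym (toList-S d arcs≡n)) (trans (cong toList eq) (toList-S d′ arcs′≡n)))

S-surjective : ∀ n (s : Subset (2 * n)) → IsTarget n s → ∃[ d ] (arcs d ≡ n × S (2 * n) d ≡ s)
S-surjective n s (∣s∣≡n , 0∉s) with word-surjective (toList s) balanced (avoids-0⇒bitAt-0 s 0∉s)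
  where
  balanced : Balanced (toList s)
  balanced = half-true⇒Balanced n (toList s) (length-toList s) (trans (occurrences-true-toList s) ∣s∣≡n)
... | d , word≡s = d , arcs≡n , S≡s
  where
  arcs≡n : arcs d ≡ n
  arcs≡n = begin
    arcs d                       ≡⟨ sym (occurrences-word true d) ⟩
    occurrences true (word d)    ≡⟨ cong (occurrences true) word≡s ⟩
    occurrences true (toList s)  ≡⟨ occurrences-true-toList s ⟩
    ∣ s ∣                        ≡⟨ ∣s∣≡n ⟩
    n                            ∎
  S≡s : S (2 * n) d ≡ s
  S≡s = trans (S≡toSubset-word _ d) (trans (cong (toSubset _) word≡s) (toSubset-toList s))

lemma4 : (n : ℕ) → 1 ≤ n →
    ((d : TBDiagram) → arcs d ≡ n → IsTarget n (S (2 * n) d))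
    × ((d d′ : TBDiagram) → arcs d ≡ n → arcs d′ ≡ n → S (2 * n) d ≡ S (2 * n) d′ → d ≡ d′)
    × ((s : Subset (2 * n)) → IsTarget n s → ∃[ d ] (arcs d ≡ n × S (2 * n) d ≡ s))
lemma4 n _ = into , S-injective , S-surjective n
  where
  into : (d : TBDiagram) → arcs d ≡ n → IsTarget n (S (2 * n) d)
  into d refl = S-IsTarget d
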